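{- Let $T$ and $T'$ be two $r$-ary GDH theories such that $J_{T'} \subseteq J_T$. If $\alpha \in [0,1)$ is a jump for $T'$, then $\alpha$ is also a jump for $T$.
   Context: For an integer $r \geq 2$ and a subgroup $J \subseteq S_r$, a GDH theory $T$ is given by $J_T = J$, with $m_T := |J_T|$. A $T$-graph $G$ is a finite set $V_G$ with a relation $E_G \subseteq V_G^r$ such that every tuple in $E_G$ has pairwise distinct entries and $E_G$ is closed under permuting coordinates by elements of $J_T$. An edge is an orbit of $E_G$ under this $J_T$-action. A number $\alpha \in [0,1)$ is a jump for $T$ if there exists $c > 0$ such that for every $\epsilon > 0$ and every positive integer $l$ there is $n_0$ such that every $T$-graph on $n \geq n_0$ vertices with at least $(\alpha+\epsilon)\frac{r!}{m_T}\binom{n}{r}$ edges contains an induced sub-$T$-graph on $l$ vertices with at least $(\alpha + c)\frac{r!}{m_T}\binom{l}{r}$ edges.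
   Formalization: In the definition of a jump, the constants c and ε range over the positive rationals. -}

module Defs where

open import Level using (0ℓ)
open import Data.Nat using (ℕ; zero; suc; _*_; _≤_; _!)
open import Data.Nat.Combinatorics using (_C_)
open import Data.Integer using (+_)
open import Data.Rational using (ℚ; _/_; _-_; _<_; 0ℚ; 1ℚ)
open import Data.Fin using (Fin)
open import Data.Vec using (Vec; lookup; tabulate; allFin; map)
open import Data.List using (List; length)
open import Data.List.Membership.Propositional using (_∈_)
open import Data.List.Relation.Unary.All using (All)
open import Data.List.Relation.Unary.AllPairs using (AllPairs)
open import Data.List.Relation.Unary.Unique.Propositional using (Unique)
open import Data.Product using (Σ; ∃; _×_)
open import Data.Unit using (⊤)
open import Relation.Nullary using (¬_)
open import Relation.Binary.PropositionalEquality using (_≡_)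
open import Function.Definitions using (Injective)

-- Permutations of Fin r, represented by their table of values
-- (σ is the map i ↦ lookup σ i).

Perm : ℕ → Set
Perm r = Vec (Fin r) r

IsPerm : ∀ {r} → Perm r → Set
IsPerm σ = Injective _≡_ _≡_ (lookup σ)

idP : (r : ℕ) → Perm r
idP r = allFin r

_∘P_ : ∀ {r} → Perm r → Perm r → Perm r
σ ∘P τ = tabulate (λ i → lookup σ (lookup τ i))

-- An r-ary GDH theory: a subgroup J_T of S_r, given as a duplicate-free
-- list of its elements (so m_T = length of the list).

record GDH (r : ℕ) : Set where
  field
    J       : List (Perm r)
    J-perm  : All IsPerm J
    J-uniq  : Unique J
    J-id    : idP r ∈ J
    J-comp  : ∀ {σ τ} → σ ∈ J → τ ∈ J → (σ ∘P τ) ∈ J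
    J-inv   : ∀ {σ} → σ ∈ J → Σ (Perm r) (λ τ → τ ∈ J × (σ ∘P τ) ≡ idP r)

open GDH public

m : ∀ {r} → GDH r → ℕ
m T = length (J T)

act : ∀ {r} {A : Set} → Perm r → Vec A r → Vec A r
act σ t = tabulate (λ i → lookup t (lookup σ i))

Distinct : ∀ {r} {A : Set} → Vec A r → Set
Distinct t = Injective _≡_ _≡_ (lookup t)

record TGraph {r : ℕ} (T : GDH r) (n : ℕ) : Set₁ where
  field
    E        : Vec (Fin n) r → Set
    distinct : ∀ {t} → E t → Distinct t
    closed   : ∀ {σ t} → σ ∈ J T → E t → E (act σ t)

open TGraph public

-- t and u lie in the same J_T-orbit, i.e. represent the same edge
SameEdge : ∀ {r} {A : Set} → GDH r → Vec A r → Vec A r → Set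
SameEdge T t u = Σ (Perm _) (λ σ → σ ∈ J T × u ≡ act σ t)

-- Real numbers: open lower Dedekind cuts of ℚ (α represented by
-- L = { q ∈ ℚ | q < α }).

record Cut : Set₁ where
  field
    L        : ℚ → Set
    inhabited : ∃ L
    bounded  : ∃ (λ q → ¬ L q)
    lower    : ∀ {p q} → q < p → L p → L q
    rounded  : ∀ {q} → L q → ∃ (λ p → q < p × L p)

open Cut public

ZeroLe : Cut → Set
ZeroLe α = ∀ q → q < 0ℚ → L α q

LtOne : Cut → Set
LtOne α = ∃ (λ q → q < 1ℚ × ¬ L α q)

-- GeqR α ε A B :  the real inequality  A ≥ (α + ε) · B  (A, B ∈ ℕ, ε ∈ ℚ).
-- For B > 0 this is  A/B - ε ≥ α,  i.e.  A/B - ε ∉ L α.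
GeqR : Cut → ℚ → ℕ → ℕ → Set
GeqR α ε A zero    = ⊤
GeqR α ε A (suc b) = ¬ L α ((+ A) / suc b - ε)

-- The relation E on Vec (Fin n) r (a T-graph on n vertices) has at least
-- (α + ε) · (r!/m_T) · C(n,r) edges: there is a list of k tuples of E lying
-- in pairwise distinct J_T-orbits (i.e. k distinct edges) with
-- k · m_T ≥ (α + ε) · r! · C(n,r).
ManyEdges : ∀ {r} → GDH r → Cut → ℚ → (n : ℕ) → (Vec (Fin n) r → Set) → Set
ManyEdges {r} T α ε n E =
  Σ (List (Vec (Fin n) r)) λ es →
    All E es × AllPairs (λ t u → ¬ SameEdge T t u) es
    × GeqR α ε (length es * m T) ((r !) * (n C r))

-- The constants c and ε range over positive rationals
-- (equivalent to ranging over positive reals).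
-- The induced sub-T-graph on l vertices is given by an injective map
-- f : Fin l → Fin n; its relation is t ↦ E (map f t).
IsJump : ∀ {r} → GDH r → Cut → Set₁
IsJump {r} T α =
  Σ ℚ λ c → 0ℚ < c ×
    (∀ (ε : ℚ) → 0ℚ < ε → ∀ (l : ℕ) → 1 ≤ l →
      ∃ λ n₀ → ∀ n → n₀ ≤ n → (G : TGraph T n) →
        ManyEdges T α ε n (E G) →
        Σ (Fin l → Fin n) λ f → Injective _≡_ _≡_ f ×
          ManyEdges T α c l (λ t → E G (map f t)))

-- The edge density of a relation E that is closed under a group J does not
-- depend on J: pairwise J-inequivalent tuples t₁ … t_k of E have k·|J|
-- distinct images, all in E, and a maximal family of pairwise
-- J′-inequivalent tuples among those images has k′ members with
-- k′·|J′| ≥ k·|J|.  Since J_{T′} ⊆ J_T, a T-graph is a T′-graph of the same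
-- density; the jump for T′ yields a dense induced subgraph, whose density
-- transfers back to T.

module Submission where

open import Defs
open import Data.Nat as ℕ using (ℕ; zero; suc; _*_; _≤_; z≤n; s≤s)
open import Data.Fin using (Fin)
import Data.Fin.Properties as FinP
open import Data.Vec as Vec using (Vec; lookup; tabulate)
import Data.Vec.Properties as VecP
open import Data.List as List using (List; []; _∷_; _++_; length)
import Data.List.Properties as ListP
open import Data.List.Membership.Propositional using (_∈_; find; lose)
open import Data.List.Membership.Propositional.Properties
  using (∈-++⁻; ∈-++⁺ˡ; ∈-++⁺ʳ; ∈-map⁺; ∈-map⁻)
open import Data.List.Relation.Binary.Subset.Propositional using (_⊆_)
open import Data.List.Relation.Unary.Any using (here; there; any?)
open import Data.List.Relation.Unary.All as All using (All; []; _∷_)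
import Data.List.Relation.Unary.All.Properties as AllP
open import Data.List.Relation.Unary.AllPairs as AllPairs using (AllPairs; []; _∷_)
import Data.List.Relation.Unary.AllPairs.Properties as AllPairsP
open import Data.List.Relation.Unary.Unique.Propositional using (Unique)
open import Data.Integer as ℤ using (+_)
import Data.Integer.Properties as ℤP
open import Data.Rational as ℚ using (ℚ; fromℚᵘ)
import Data.Rational.Properties as ℚP
open import Data.Rational.Unnormalised as ℚᵘ using (ℚᵘ; mkℚᵘ; *≤*)
import Data.Rational.Unnormalised.Properties as ℚᵘP
open import Data.Product using (Σ; ∃; _×_; _,_)
open import Data.Sum using (inj₁; inj₂)
open import Data.Empty using (⊥-elim)
open import Function using (_∘_)
open import Relation.Nullary using (¬_; yes; no)
open import Relation.Binary.Definitions using (DecidableEquality; Decidable)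
open import Relation.Binary.PropositionalEquality hiding (J)
open ≡-Reasoning

module _ {r : ℕ} {A : Set} where

  lookup-act : (σ : Perm r) (t : Vec A r) (i : Fin r) →
               lookup (act σ t) i ≡ lookup t (lookup σ i)
  lookup-act σ t = VecP.lookup∘tabulate (lookup t ∘ lookup σ)

  act-idP : (t : Vec A r) → act (idP r) t ≡ t
  act-idP t = trans (VecP.tabulate-cong (cong (lookup t) ∘ VecP.lookup-allFin))
                    (VecP.tabulate∘lookup t)

  act-∘P : (σ τ : Perm r) (t : Vec A r) → act τ (act σ t) ≡ act (σ ∘P τ) t
  act-∘P σ τ t = VecP.tabulate-cong λ i → begin
    lookup (act σ t) (lookup τ i)   ≡⟨ lookup-act σ t (lookup τ i) ⟩
    lookup t (lookup σ (lookup τ i)) ≡⟨ cong (lookup t) (VecP.lookup∘tabulate _ i) ⟨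
    lookup t (lookup (σ ∘P τ) i)     ∎

  act-injectiveˡ : ∀ {σ σ′ : Perm r} {t : Vec A r} →
                   Distinct t → act σ t ≡ act σ′ t → σ ≡ σ′
  act-injectiveˡ {σ} {σ′} {t} t-distinct eq = begin
    σ                   ≡⟨ VecP.tabulate∘lookup σ ⟨
    tabulate (lookup σ)  ≡⟨ VecP.tabulate-cong lookupσ≗lookupσ′ ⟩
    tabulate (lookup σ′) ≡⟨ VecP.tabulate∘lookup σ′ ⟩
    σ′                  ∎
    where
    lookupσ≗lookupσ′ : ∀ i → lookup σ i ≡ lookup σ′ i
    lookupσ≗lookupσ′ i = t-distinct (begin
      lookup t (lookup σ i)  ≡⟨ lookup-act σ t i ⟨
      lookup (act σ t) i    ≡⟨ cong (λ v → lookup v i) eq ⟩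
      lookup (act σ′ t) i   ≡⟨ lookup-act σ′ t i ⟩
      lookup t (lookup σ′ i) ∎)

  module _ {B : Set} (f : A → B) where

    map-act : (σ : Perm r) (t : Vec A r) → Vec.map f (act σ t) ≡ act σ (Vec.map f t)
    map-act σ t = begin
      Vec.map f (tabulate (lookup t ∘ lookup σ)) ≡⟨ VecP.tabulate-∘ f _ ⟨
      tabulate (f ∘ lookup t ∘ lookup σ)         ≡⟨ VecP.tabulate-cong lookup-map-σ ⟨
      act σ (Vec.map f t)                        ∎
      where
      lookup-map-σ : ∀ i → lookup (Vec.map f t) (lookup σ i) ≡ f (lookup t (lookup σ i))
      lookup-map-σ i = VecP.lookup-map (lookup σ i) f t

    Distinct-map⁻ : {t : Vec A r} → Distinct (Vec.map f t) → Distinct t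
    Distinct-map⁻ {t} ft-distinct {i} {j} eq = ft-distinct (begin
      lookup (Vec.map f t) i ≡⟨ VecP.lookup-map i f t ⟩
      f (lookup t i)         ≡⟨ cong f eq ⟩
      f (lookup t j)         ≡⟨ VecP.lookup-map j f t ⟨
      lookup (Vec.map f t) j ∎)

weaken : ∀ {r n} {T T′ : GDH r} → J T′ ⊆ J T → TGraph T n → TGraph T′ n
weaken J′⊆J G = record
  { E = E G ; distinct = distinct G ; closed = closed G ∘ J′⊆J }

induced : ∀ {r n l} {T : GDH r} → TGraph T n → (Fin l → Fin n) → TGraph T l
induced G f = record
  { E        = E G ∘ Vec.map f
  ; distinct = λ {t} e → Distinct-map⁻ f {t} (distinct G e)
  ; closed   = λ {σ} {t} σ∈J e → subst (E G) (sym (map-act f σ t)) (closed G σ∈J e)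
  }

module _ {r : ℕ} (K : GDH r) {A : Set} where

  SameEdge-refl : (t : Vec A r) → SameEdge K t t
  SameEdge-refl t = idP r , J-id K , sym (act-idP t)

  SameEdge-sym : {t u : Vec A r} → SameEdge K t u → SameEdge K u t
  SameEdge-sym {t} (σ , σ∈J , refl) =
    let τ , τ∈J , σ∘τ≡id = J-inv K σ∈J in
    τ , τ∈J , sym (begin
      act τ (act σ t)  ≡⟨ act-∘P σ τ t ⟩
      act (σ ∘P τ) t   ≡⟨ cong (λ π → act π t) σ∘τ≡id ⟩
      act (idP r) t    ≡⟨ act-idP t ⟩
      t                ∎)

  SameEdge-trans : {t u v : Vec A r} → SameEdge K t u → SameEdge K u v → SameEdge K t v
  SameEdge-trans {t} (σ , σ∈J , refl) (τ , τ∈J , refl) =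
    σ ∘P τ , J-comp K σ∈J τ∈J , act-∘P σ τ t

  DifferentEdges : Vec A r → Vec A r → Set
  DifferentEdges t u = ¬ SameEdge K t u

  orbit : Vec A r → List (Vec A r)
  orbit t = List.map (λ σ → act σ t) (J K)

  orbits : List (Vec A r) → List (Vec A r)
  orbits []       = []
  orbits (t ∷ ts) = orbit t ++ orbits ts

  length-orbits : (ts : List (Vec A r)) → length (orbits ts) ≡ length ts * m K
  length-orbits []       = refl
  length-orbits (t ∷ ts) = trans (ListP.length-++ (orbit t))
    (cong₂ ℕ._+_ (ListP.length-map _ (J K)) (length-orbits ts))

  ∈-orbits⁻ : ∀ {x} ts → x ∈ orbits ts → ∃ λ t → t ∈ ts × SameEdge K t x
  ∈-orbits⁻ (t ∷ ts) x∈ with ∈-++⁻ (orbit t) x∈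
  ... | inj₁ x∈orbit = let σ , σ∈J , x≡σt = ∈-map⁻ (λ σ → act σ t) x∈orbit in
                       t , here refl , σ , σ∈J , x≡σt
  ... | inj₂ x∈rest  = let u , u∈ts , u~x = ∈-orbits⁻ ts x∈rest in u , there u∈ts , u~x

  ∈-orbits⁺ : ∀ {x t ts} → t ∈ ts → SameEdge K t x → x ∈ orbits ts
  ∈-orbits⁺ {t = t} (here refl) (σ , σ∈J , refl) = ∈-++⁺ˡ (∈-map⁺ (λ σ → act σ t) σ∈J)
  ∈-orbits⁺ {ts = u ∷ _} (there t∈ts) t~x = ∈-++⁺ʳ (orbit u) (∈-orbits⁺ t∈ts t~x)

  Unique-orbits : ∀ ts → All Distinct ts → AllPairs DifferentEdges ts → Unique (orbits ts)
  Unique-orbits []       _                       _                   = []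
  Unique-orbits (t ∷ ts) (t-distinct ∷ distinct) (t≁ts ∷ different) =
    AllPairsP.++⁺ Unique-orbit (Unique-orbits ts distinct different)
      (All.tabulate λ x∈ → All.tabulate λ y∈ → orbits-disjoint x∈ y∈)
    where
    Unique-orbit : Unique (orbit t)
    Unique-orbit = AllPairsP.map⁺ (AllPairs.map
      (λ {σ} {σ′} σ≢σ′ → σ≢σ′ ∘ act-injectiveˡ {σ = σ} {σ′} {t} t-distinct) (J-uniq K))

    orbits-disjoint : ∀ {x y} → x ∈ orbit t → y ∈ orbits ts → x ≢ y
    orbits-disjoint x∈ y∈ refl =
      let σ , σ∈J , x≡σt = ∈-map⁻ (λ σ → act σ t) x∈
          u , u∈ts , u~x = ∈-orbits⁻ ts y∈
      in All.lookup t≁ts u∈ts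
           (SameEdge-trans {t = t} (σ , σ∈J , x≡σt) (SameEdge-sym {t = u} u~x))

  All-orbits : {P : Vec A r → Set} → (∀ {σ t} → σ ∈ J K → P t → P (act σ t)) →
               ∀ {ts} → All P ts → All P (orbits ts)
  All-orbits {P} P-closed {ts} Pts = All.tabulate λ x∈ →
    let t , t∈ts , σ , σ∈J , x≡σt = ∈-orbits⁻ ts x∈ in
    subst P (sym x≡σt) (P-closed σ∈J (All.lookup Pts t∈ts))

  module _ (_≟_ : DecidableEquality A) where

    sameEdge? : Decidable (SameEdge {A = A} K)
    sameEdge? t u with any? (λ σ → VecP.≡-dec _≟_ u (act σ t)) (J K)
    ... | yes found   = yes (find found)
    ... | no notFound = no λ (σ , σ∈J , u≡σt) → notFound (lose σ∈J u≡σt)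

    record Representatives (ts : List (Vec A r)) : Set where
      field
        reps           : List (Vec A r)
        reps⊆          : reps ⊆ ts
        reps-different : AllPairs DifferentEdges reps
        reps-cover     : ∀ {x} → x ∈ ts → ∃ λ y → y ∈ reps × SameEdge K y x

    representatives : ∀ ts → Representatives ts
    representatives [] = record
      { reps = [] ; reps⊆ = λ () ; reps-different = [] ; reps-cover = λ () }
    representatives (x ∷ ts) with representatives ts
    ... | record { reps = ys ; reps⊆ = ys⊆ ; reps-different = ys-diff ; reps-cover = ys-cover }
        with any? (sameEdge? x) ys
    ... | yes x~ys = record
      { reps = ys ; reps⊆ = there ∘ ys⊆ ; reps-different = ys-diff
      ; reps-cover = λ { (here refl) → let y , y∈ , x~y = find x~ys in y , y∈ , SameEdge-sym x~y
                       ; (there x∈) → ys-cover x∈ } }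
    ... | no x≁ys = record
      { reps = x ∷ ys
      ; reps⊆ = λ { (here refl) → here refl ; (there y∈) → there (ys⊆ y∈) }
      ; reps-different = All.tabulate (λ y∈ x~y → x≁ys (lose y∈ x~y)) ∷ ys-diff
      ; reps-cover = λ { (here refl) → x , here refl , SameEdge-refl x
                       ; (there x∈) → let y , y∈ , y~x = ys-cover x∈ in y , there y∈ , y~x } }

module _ {A : Set} where

  ∈⇒removal : ∀ {x ys} → x ∈ ys → Σ (List A) λ zs →
              length ys ≡ suc (length zs) × (∀ {z} → z ∈ ys → z ≢ x → z ∈ zs)
  ∈⇒removal {ys = _ ∷ zs} (here refl) =
    zs , refl , λ { (here refl) z≢x → ⊥-elim (z≢x refl) ; (there z∈) _ → z∈ }
  ∈⇒removal {ys = y ∷ _} (there x∈) =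
    let zs , length≡ , ys-x⊆zs = ∈⇒removal x∈ in
    y ∷ zs , cong suc length≡ , λ { (here refl) _ → here refl
                                  ; (there z∈) z≢x → there (ys-x⊆zs z∈ z≢x) }

  Unique-⊆⇒length≤ : {xs ys : List A} → Unique xs → xs ⊆ ys → length xs ≤ length ys
  Unique-⊆⇒length≤ {[]}     _               _     = z≤n
  Unique-⊆⇒length≤ {x ∷ xs} (x∉xs ∷ unique) xs⊆ys
    with zs , length≡ , ys-x⊆zs ← ∈⇒removal (xs⊆ys (here refl)) rewrite length≡ =
    s≤s (Unique-⊆⇒length≤ unique λ z∈xs →
      ys-x⊆zs (xs⊆ys (there z∈xs)) λ z≡x → All.lookup x∉xs z∈xs (sym z≡x))

L-≤-closed : (α : Cut) {p q : ℚ} → p ℚ.≤ q → L α q → L α p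
L-≤-closed α p≤q q∈L = let q′ , q<q′ , q′∈L = rounded α q∈L in
  lower α (ℚP.≤-<-trans p≤q q<q′) q′∈L

fromℚᵘ-mono-≤ : {p q : ℚᵘ} → p ℚᵘ.≤ q → fromℚᵘ p ℚ.≤ fromℚᵘ q
fromℚᵘ-mono-≤ {p} {q} p≤q = ℚP.toℚᵘ-cancel-≤
  (ℚᵘP.≤-respʳ-≃ (ℚᵘP.≃-sym (ℚP.toℚᵘ-fromℚᵘ q))
    (ℚᵘP.≤-respˡ-≃ (ℚᵘP.≃-sym (ℚP.toℚᵘ-fromℚᵘ p)) p≤q))

GeqR-monoˡ : ∀ α ε {A A′} B → A ≤ A′ → GeqR α ε A B → GeqR α ε A′ B
GeqR-monoˡ α ε zero _ _ = _
GeqR-monoˡ α ε {A} {A′} (suc b) A≤A′ A-dense A′/B-ε∈L =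
  A-dense (L-≤-closed α (ℚP.+-monoˡ-≤ (ℚ.- ε) A/B≤A′/B) A′/B-ε∈L)
  where
  A/B≤A′/B : (+ A) ℚ./ suc b ℚ.≤ (+ A′) ℚ./ suc b
  A/B≤A′/B = fromℚᵘ-mono-≤ {mkℚᵘ (+ A) b} {mkℚᵘ (+ A′) b}
    (*≤* (ℤP.*-monoʳ-≤-nonNeg (+ suc b) (ℤ.+≤+ A≤A′)))

manyEdges-transfer : ∀ {r n} (K₁ K₂ : GDH r) (G : TGraph K₁ n) α ε →
                     ManyEdges K₁ α ε n (E G) → ManyEdges K₂ α ε n (E G)
manyEdges-transfer K₁ K₂ G α ε (es , es∈E , es-different , dense) =
  reps , AllP.anti-mono reps⊆ (All-orbits K₁ (closed G) es∈E) , reps-different ,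
  GeqR-monoˡ α ε _ weight≤ dense
  where
  open Representatives (representatives K₂ FinP._≟_ (orbits K₁ es))

  orbits⊆ : orbits K₁ es ⊆ orbits K₂ reps
  orbits⊆ x∈ = let y , y∈ , y~x = reps-cover x∈ in ∈-orbits⁺ K₂ y∈ y~x

  weight≤ : length es * m K₁ ≤ length reps * m K₂
  weight≤ = subst₂ _≤_ (length-orbits K₁ es) (length-orbits K₂ reps)
    (Unique-⊆⇒length≤ (Unique-orbits K₁ es (All.map (distinct G) es∈E) es-different) orbits⊆)

mainTheorem10 : (r : ℕ) → 2 ≤ r → (T T′ : GDH r) →
                (∀ {σ} → σ ∈ J T′ → σ ∈ J T) →
                (α : Cut) → ZeroLe α → LtOne α →
                IsJump T′ α → IsJump T α
mainTheorem10 r _ T T′ J′⊆J α _ _ (c , c>0 , jump′) = c , c>0 , λ ε ε>0 l l≥1 →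
  let n₀ , large′ = jump′ ε ε>0 l l≥1 in
  n₀ , λ n n≥n₀ G dense →
    let f , f-injective , dense′ =
          large′ n n≥n₀ (weaken J′⊆J G) (manyEdges-transfer T T′ G α ε dense)
    in f , f-injective , manyEdges-transfer T′ T (weaken J′⊆J (induced G f)) α c dense′
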